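{- Let $n\geq 2$ be an integer and let $\mathbf{d}=(3,2,\ldots,2,1)\in\mathbb{Z}_+^{n}$ (first entry $3$, last entry $1$, all other $n-2$ entries equal to $2$) and $\mathbf{t}=(n,n)\in\mathbb{Z}_+^2$. Then the pair $(\mathbf{d};\mathbf{t})$ is not realizable, i.e., it is not the degree sequence of any geographic plan.
   Context: Graphs are finite and undirected, with loops and multiple edges allowed; a loop contributes $2$ to the degree of its vertex. A map is an embedding of a connected graph $G=(V,E)$ in a compact surface without boundary such that edges meet only at common endpoints and every connected component of the complement of the image (a country) is homeomorphic to an open disk. The dual graph $G^*$ has the countries as vertices and has the same edge set $E$: each edge $e$ joins the one or two countries on whose boundary it lies. A plan is a pair $(G,H)$ of graphs with a common edge set; it is geographic if there is a map of $G$ such that $H$ is its dual graph $G^*$ (with the given identification of edges). If $G$ has degree sequence $\mathbf{d}$ and $H$ has degree sequence $\mathbf{t}$ (up to ordering), then $(\mathbf{d};\mathbf{t})$ is the degree sequence of the plan. A pair $(\mathbf{d};\mathbf{t})$ is realizable if it is the degree sequence of some geographic plan. -}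

module Defs where

open import Data.Nat using (ℕ; zero; suc; _*_; _∸_; _≤_)
open import Data.Fin using (Fin; toℕ)
open import Data.Fin.Properties using () renaming (_≟_ to _≟F_)
import Data.Nat as N
open import Data.List using (List; length; filter; allFin)
open import Data.Product using (Σ; ∃; _×_; _,_)
open import Relation.Binary.PropositionalEquality using (_≡_; _≢_)
open import Relation.Nullary using (¬_; yes; no)
open import Data.Empty using (⊥)
open import Data.Unit using (⊤)

-- Maps on compact surfaces (orientable or not), encoded combinatorially
-- as generalized maps (graph-encoded maps / "gems"): a finite set of
-- flags Fin N with three fixed-point-free involutions α₀ α₁ α₂ such that
-- α₀ α₂ = α₂ α₀ is also fixed-point-free, and the generated group acts
-- transitively (connectedness).
--   vertices  = orbits of ⟨α₁, α₂⟩
--   edges     = orbits of ⟨α₀, α₂⟩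
--   countries = orbits of ⟨α₀, α₁⟩
-- A vertex (resp. country) of degree k (loops / edges with the same
-- country on both sides counted twice) is an orbit of exactly 2k flags.

data Gen : Set where
  g₀ g₁ g₂ : Gen

data Orb {N : ℕ} (α : Gen → Fin N → Fin N) (ok : Gen → Set) : Fin N → Fin N → Set where
  here : ∀ {x} → Orb α ok x x
  step : ∀ {x y} g → ok g → Orb α ok (α g x) y → Orb α ok x y

record GMap (N : ℕ) : Set where
  field
    α       : Gen → Fin N → Fin N
    invol   : ∀ g x → α g (α g x) ≡ x
    fpf     : ∀ g x → α g x ≢ x
    comm02  : ∀ x → α g₀ (α g₂ x) ≡ α g₂ (α g₀ x)
    fpf02   : ∀ x → α g₀ (α g₂ x) ≢ x

    connected : ∀ x y → Orb α (λ _ → ⊤) x y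

VertGen : Gen → Set
VertGen g₀ = ⊥
VertGen g₁ = ⊤
VertGen g₂ = ⊤

FaceGen : Gen → Set
FaceGen g₀ = ⊤
FaceGen g₁ = ⊤
FaceGen g₂ = ⊥

countLabel : ∀ {N k} → (Fin N → Fin k) → Fin k → ℕ
countLabel {N} c i = length (filter (λ x → c x ≟F i) (allFin N))

-- Since the labels can be permuted freely, this says the degree
-- sequence of these cells equals s up to ordering.
CellDegrees : ∀ {N} → GMap N → (Gen → Set) → (k : ℕ) → (Fin k → ℕ) → Set
CellDegrees {N} M ok k s =
  Σ (Fin N → Fin k) λ c →
      (∀ g x → ok g → c (GMap.α M g x) ≡ c x)
    × (∀ x y → c x ≡ c y → Orb (GMap.α M) ok x y)
    × (∀ i → countLabel c i ≡ 2 * s i)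

Realizable : (n : ℕ) → (Fin n → ℕ) → (m : ℕ) → (Fin m → ℕ) → Set
Realizable n d m t =
  ∃ λ N → Σ (GMap N) λ M → CellDegrees M VertGen n d × CellDegrees M FaceGen m t

dSeq : (n : ℕ) → Fin n → ℕ
dSeq n i with toℕ i N.≟ 0
... | yes _ = 3
... | no _ with toℕ i N.≟ (n ∸ 1)
...   | yes _ = 1
...   | no _ = 2

tSeq : (n : ℕ) → Fin 2 → ℕ
tSeq n _ = n

{-# OPTIONS --safe #-}
-- Let A be the country containing the leaf, B the other one, and call a flag interior if its edge
-- has B on both sides. Both countries have the same number of flags, so sorting the flags of each
-- country by whether their α₂-neighbour lies in the same country shows that B has as many interior
-- flags as A has such flags; A has some (at the leaf), so interior flags exist. They are closed
-- under α₀ and α₂, and under α₁ at vertices of degree 2, where α₁ and α₂ commute. There are none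
-- at the vertex w of degree 3: all interior flags, and those away from w, are unions of free orbits
-- of ⟨α₀, α₂⟩ and of ⟨α₁, α₂⟩ respectively, so their number at w is divisible by 4 (a handshake
-- parity); if there were any, they would be 4 of the 6 flags at w, and then the remaining two,
-- u and α₂ u, would be interior as well, since α₁ u and α₁ (α₂ u) are. So the interior flags are
-- closed under α₀, α₁, α₂, and by connectedness the flags at the leaf would be interior too,
-- although they lie in A.
module Submission where

open import Defs
open import Level using (Level; 0ℓ)
open import Function using (_∘_)
import Data.Nat as N
open import Data.Nat using (ℕ; zero; suc; _+_; _*_; _≤_; _<_; z≤n; s≤s; z<s)
open import Data.Nat.Properties
  using (≤-antisym; ≤-reflexive; <-irrefl; <⇒≱; n≤0⇒n≡0; m<m+n; m<n+m; +-suc; +-comm; +-cancelˡ-≡; +-cancelʳ-≡;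
         module ≤-Reasoning)
open import Data.Nat.Divisibility using (_∣_; divides; _∣0; ∣-refl; ∣m∣n⇒∣m+n; ∣m+n∣m⇒∣n)
open import Data.Nat.Induction using (<-wellFounded)
open import Induction.WellFounded using (Acc; acc)
open import Data.Fin using (Fin; zero; suc; opposite; toℕ; fromℕ)
open import Data.Fin.Properties using (_≟_; any?; toℕ-injective; toℕ-fromℕ)
open import Data.List using (List; []; _∷_; length; filter; allFin; map)
open import Data.List.Properties using (filter-notAll; length-map)
open import Data.List.Relation.Unary.All as All using (All; []; _∷_)
open import Data.List.Relation.Unary.Any as Any using (here; there)
open import Data.List.Relation.Unary.Unique.Propositional using (Unique; []; _∷_)
open import Data.List.Relation.Unary.Unique.Propositional.Properties using (allFin⁺; filter⁺; map⁺)
open import Data.List.Membership.Propositional using (_∈_; _∉_)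
open import Data.List.Membership.Propositional.Properties using (∈-filter⁺; ∈-filter⁻; ∈-allFin; ∈-map⁻)
open import Data.Product using (∃; _,_; proj₁; proj₂; swap)
open import Data.Empty using (⊥)
open import Relation.Binary.Definitions using (DecidableEquality)
open import Relation.Binary.PropositionalEquality
  using (_≡_; _≢_; refl; sym; trans; cong; subst; module ≡-Reasoning)
open import Relation.Nullary using (¬_; Dec; yes; no; ¬?; contradiction)
open import Relation.Unary using (Pred; Decidable; _∩_; ∁)
open import Relation.Unary.Properties using (_∩?_; ∁?)

private
  variable
    a p q : Level
    T : Set a
    N : ℕ

module _ {f : T → T} (f-involutive : ∀ x → f (f x) ≡ x) where

  open import Algebra.Consequences.Propositional {A = T} using (selfInverse⇒injective)

  involutive⇒selfInverse : ∀ {x y} → f x ≡ y → f y ≡ x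
  involutive⇒selfInverse {x} fx≡y = trans (cong f (sym fx≡y)) (f-involutive x)

  involutive⇒injective : ∀ {x y} → f x ≡ f y → x ≡ y
  involutive⇒injective = selfInverse⇒injective involutive⇒selfInverse

module _ (_≟ᵀ_ : DecidableEquality T) where

  unique-⊆⇒length≤ : {xs ys : List T} → Unique xs → (∀ {x} → x ∈ xs → x ∈ ys) → length xs ≤ length ys
  unique-⊆⇒length≤ {xs = []}     _             _      = z≤n
  unique-⊆⇒length≤ {xs = x ∷ xs} {ys} (x∉xs ∷ xs!) xs⊆ys = begin-strict
    length xs                  ≤⟨ unique-⊆⇒length≤ xs! xs⊆ys-x ⟩
    length (filter (x ≢?_) ys) <⟨ filter-notAll (x ≢?_) ys (Any.map (λ x≡y x≢y → x≢y x≡y) (xs⊆ys (here refl))) ⟩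
    length ys                  ∎
    where
    open ≤-Reasoning
    _≢?_ : (x y : T) → Dec (x ≢ y)
    x ≢? y = ¬? (x ≟ᵀ y)
    xs⊆ys-x : ∀ {y} → y ∈ xs → y ∈ filter (x ≢?_) ys
    xs⊆ys-x y∈xs = ∈-filter⁺ (x ≢?_) (xs⊆ys (there y∈xs)) (All.lookup x∉xs y∈xs)

length-filter-split : {P : Pred T p} {Q : Pred T q} (P? : Decidable P) (Q? : Decidable Q) (xs : List T) →
  length (filter P? xs) ≡ length (filter (P? ∩? Q?) xs) + length (filter (P? ∩? ∁? Q?) xs)
length-filter-split P? Q? []       = refl
length-filter-split P? Q? (x ∷ xs) with P? x | Q? x
... | yes _ | yes _ = cong suc (length-filter-split P? Q? xs)
... | yes _ | no _  = trans (cong suc (length-filter-split P? Q? xs)) (sym (+-suc _ _))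
... | no _  | _     = length-filter-split P? Q? xs

members : {P : Pred (Fin N) p} → Decidable P → List (Fin N)
members P? = filter P? (allFin _)

count : {P : Pred (Fin N) p} → Decidable P → ℕ
count P? = length (members P?)

module _ {P : Pred (Fin N) p} (P? : Decidable P) where

  members-unique : Unique (members P?)
  members-unique = filter⁺ P? (allFin⁺ _)

  ∈-members⁺ : ∀ {x} → P x → x ∈ members P?
  ∈-members⁺ {x} = ∈-filter⁺ P? {xs = allFin _} (∈-allFin x)

  ∈-members⁻ : ∀ {x} → x ∈ members P? → P x
  ∈-members⁻ = proj₂ ∘ ∈-filter⁻ P? {xs = allFin _}

  unique⇒length≤count : {xs : List (Fin N)} → Unique xs → All P xs → length xs ≤ count P?
  unique⇒length≤count xs! Pxs = unique-⊆⇒length≤ _≟_ xs! (∈-members⁺ ∘ All.lookup Pxs)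

  count≤length : {xs : List (Fin N)} → (∀ {x} → P x → x ∈ xs) → count P? ≤ length xs
  count≤length P⊆xs = unique-⊆⇒length≤ _≟_ members-unique (P⊆xs ∘ ∈-members⁻)

  count-empty : (∀ x → ¬ P x) → count P? ≡ 0
  count-empty ¬P = n≤0⇒n≡0 (count≤length {xs = []} (λ {x} Px → contradiction Px (¬P x)))

  count-witness : 0 < count P? → ∃ P
  count-witness 0<count with any? P?
  ... | yes ∃P  = ∃P
  ... | no  ¬∃P = contradiction (count-empty (λ x Px → ¬∃P (x , Px))) (λ count≡0 → <-irrefl (sym count≡0) 0<count)

  count-split : {Q : Pred (Fin N) q} (Q? : Decidable Q) → count P? ≡ count (P? ∩? Q?) + count (P? ∩? ∁? Q?)
  count-split Q? = length-filter-split P? Q? (allFin _)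

count-mono : {P : Pred (Fin N) p} {Q : Pred (Fin N) q} (P? : Decidable P) (Q? : Decidable Q) →
             (∀ {x} → P x → Q x) → count P? ≤ count Q?
count-mono P? Q? P⊆Q = unique-⊆⇒length≤ _≟_ (members-unique P?) (∈-members⁺ Q? ∘ P⊆Q ∘ ∈-members⁻ P?)

count-cong : {P : Pred (Fin N) p} {Q : Pred (Fin N) q} (P? : Decidable P) (Q? : Decidable Q) →
             (∀ {x} → P x → Q x) → (∀ {x} → Q x → P x) → count P? ≡ count Q?
count-cong P? Q? P⊆Q Q⊆P = ≤-antisym (count-mono P? Q? P⊆Q) (count-mono Q? P? Q⊆P)

module _ {N : ℕ} {P : Pred (Fin N) p} (P? : Decidable P) where

  open import Data.List.Membership.DecPropositional (_≟_ {N}) using (_∈?_)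

  count-remove : {xs : List (Fin N)} → Unique xs → All P xs → count P? ≡ length xs + count (P? ∩? ∁? (_∈? xs))
  count-remove {xs} xs! Pxs = trans (count-split P? (_∈? xs)) (cong (_+ count (P? ∩? ∁? (_∈? xs))) in-xs≡length)
    where
    in-xs≡length : count (P? ∩? (_∈? xs)) ≡ length xs
    in-xs≡length = ≤-antisym (count≤length (P? ∩? (_∈? xs)) proj₂)
      (unique⇒length≤count (P? ∩? (_∈? xs)) xs! (All.tabulate λ x∈xs → All.lookup Pxs x∈xs , x∈xs))

  count-saturated : {xs : List (Fin N)} → Unique xs → All P xs → count P? ≤ length xs → ∀ {x} → P x → x ∈ xs
  count-saturated {xs} xs! Pxs count≤length {x} Px with x ∈? xs
  ... | yes x∈xs = x∈xs
  ... | no  x∉xs = contradiction (begin-strict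
        length xs                             <⟨ m<m+n (length xs) outside-xs ⟩
        length xs + count (P? ∩? ∁? (_∈? xs)) ≡⟨ count-remove xs! Pxs ⟨
        count P?                              ≤⟨ count≤length ⟩
        length xs                             ∎) (<-irrefl refl)
    where
    open ≤-Reasoning
    outside-xs : 0 < count (P? ∩? ∁? (_∈? xs))
    outside-xs = unique⇒length≤count (P? ∩? ∁? (_∈? xs)) ([] ∷ []) ((Px , x∉xs) ∷ [])

count-∘-injective : {P : Pred (Fin N) p} (P? : Decidable P) {σ : Fin N → Fin N} →
                    (∀ {x y} → σ x ≡ σ y → x ≡ y) → count (P? ∘ σ) ≤ count P?
count-∘-injective P? {σ} σ-injective = begin
  count (P? ∘ σ)                    ≡⟨ length-map σ (members (P? ∘ σ)) ⟨
  length (map σ (members (P? ∘ σ))) ≤⟨ unique-⊆⇒length≤ _≟_ (map⁺ σ-injective (members-unique (P? ∘ σ))) image⊆P ⟩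
  count P?                          ∎
  where
  open ≤-Reasoning
  image⊆P : ∀ {y} → y ∈ map σ (members (P? ∘ σ)) → y ∈ members P?
  image⊆P y∈image with ∈-map⁻ σ y∈image
  ... | x , x∈members , refl = ∈-members⁺ P? (∈-members⁻ (P? ∘ σ) x∈members)

count-∘-involutive : {P : Pred (Fin N) p} (P? : Decidable P) {σ : Fin N → Fin N} →
                     (∀ x → σ (σ x) ≡ x) → count (P? ∘ σ) ≡ count P?
count-∘-involutive {P = P} P? {σ} σ-involutive = ≤-antisym (count-∘-injective P? σ-injective) (begin
  count P?           ≡⟨ count-cong P? (P? ∘ σ ∘ σ) (subst P (sym (σ-involutive _))) (subst P (σ-involutive _)) ⟩
  count (P? ∘ σ ∘ σ) ≤⟨ count-∘-injective (P? ∘ σ) σ-injective ⟩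
  count (P? ∘ σ)     ∎)
  where
  open ≤-Reasoning
  σ-injective : ∀ {x y} → σ x ≡ σ y → x ≡ y
  σ-injective = involutive⇒injective σ-involutive

count-∩-∘-balanced : {C : Pred (Fin N) p} (C? : Decidable C) {σ : Fin N → Fin N} → (∀ x → σ (σ x) ≡ x) →
                     count C? ≡ count (∁? C?) → count (C? ∩? C? ∘ σ) ≡ count (∁? C? ∩? ∁? C? ∘ σ)
count-∩-∘-balanced {C = C} C? {σ} σ-involutive balanced = +-cancelʳ-≡ _ _ _ (begin
  count (C? ∩? C? ∘ σ) + count (C? ∩? ∁? C? ∘ σ)        ≡⟨ count-split C? (C? ∘ σ) ⟨
  count C?                                              ≡⟨ balanced ⟩
  count (∁? C?)                                         ≡⟨ count-split (∁? C?) (C? ∘ σ) ⟩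
  count (∁? C? ∩? C? ∘ σ) + count (∁? C? ∩? ∁? C? ∘ σ)  ≡⟨ cong (_+ count (∁? C? ∩? ∁? C? ∘ σ)) crossing ⟩
  count (C? ∩? ∁? C? ∘ σ) + count (∁? C? ∩? ∁? C? ∘ σ)  ≡⟨ +-comm (count (C? ∩? ∁? C? ∘ σ)) _ ⟩
  count (∁? C? ∩? ∁? C? ∘ σ) + count (C? ∩? ∁? C? ∘ σ)  ∎)
  where
  open ≡-Reasoning
  crossing : count (∁? C? ∩? C? ∘ σ) ≡ count (C? ∩? ∁? C? ∘ σ)
  crossing = trans
    (count-cong (∁? C? ∩? C? ∘ σ) ((C? ∩? ∁? C? ∘ σ) ∘ σ)
      (λ {x} (¬Cx , Cσx) → Cσx , ¬Cx ∘ subst C (σ-involutive x))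
      (λ {x} (Cσx , ¬Cσσx) → ¬Cσσx ∘ subst C (sym (σ-involutive x)) , Cσx))
    (count-∘-involutive (C? ∩? ∁? C? ∘ σ) σ-involutive)

module KleinOrbit {N : ℕ} (σ τ : Fin N → Fin N)
  (σ-involutive : ∀ x → σ (σ x) ≡ x) (τ-involutive : ∀ x → τ (τ x) ≡ x)
  (σ-fpf : ∀ x → σ x ≢ x) (τ-fpf : ∀ x → τ x ≢ x) where

  open import Data.List.Membership.DecPropositional (_≟_ {N}) using (_∈?_)

  private
    variable
      x y : Fin N

    σ-selfInverse : σ x ≡ y → σ y ≡ x
    σ-selfInverse = involutive⇒selfInverse σ-involutive

    τ-selfInverse : τ x ≡ y → τ y ≡ x
    τ-selfInverse = involutive⇒selfInverse τ-involutive

    σ-injective : σ x ≡ σ y → x ≡ y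
    σ-injective = involutive⇒injective σ-involutive

    τ-injective : τ x ≡ τ y → x ≡ y
    τ-injective = involutive⇒injective τ-involutive

  orbit : Fin N → List (Fin N)
  orbit x = x ∷ σ x ∷ τ x ∷ σ (τ x) ∷ []

  orbit-unique : σ (τ x) ≢ x → Unique (orbit x)
  orbit-unique {x} στx≢x =
      (σ-fpf x ∘ sym ∷ τ-fpf x ∘ sym ∷ στx≢x ∘ sym ∷ [])
    ∷ (σx≢τx ∷ τ-fpf x ∘ sym ∘ σ-injective ∷ [])
    ∷ (σ-fpf (τ x) ∘ sym ∷ [])
    ∷ [] ∷ []
    where
    σx≢τx : σ x ≢ τ x
    σx≢τx σx≡τx = στx≢x (trans (cong σ (sym σx≡τx)) (σ-involutive x))

  σ-orbit⁻ : σ y ∈ orbit x → y ∈ orbit x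
  σ-orbit⁻ (here σy≡x)                           = there (here (sym (σ-selfInverse σy≡x)))
  σ-orbit⁻ (there (here σy≡σx))                  = here (σ-injective σy≡σx)
  σ-orbit⁻ (there (there (here σy≡τx)))          = there (there (there (here (sym (σ-selfInverse σy≡τx)))))
  σ-orbit⁻ (there (there (there (here σy≡στx)))) = there (there (here (σ-injective σy≡στx)))

  τ-orbit⁻ : σ (τ x) ≡ τ (σ x) → τ y ∈ orbit x → y ∈ orbit x
  τ-orbit⁻ _    (here τy≡x)                           = there (there (here (sym (τ-selfInverse τy≡x))))
  τ-orbit⁻ comm (there (here τy≡σx))                  = there (there (there (here (sym (trans comm (τ-selfInverse τy≡σx))))))
  τ-orbit⁻ _    (there (there (here τy≡τx)))          = here (τ-injective τy≡τx)
  τ-orbit⁻ comm (there (there (there (here τy≡στx)))) = there (here (τ-injective (trans τy≡στx comm)))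

  record ActsFreelyOn (S : Pred (Fin N) p) : Set p where
    field
      σ-closed : S x → S (σ x)
      τ-closed : S x → S (τ x)
      commute  : S x → σ (τ x) ≡ τ (σ x)
      στ-fpf   : S x → σ (τ x) ≢ x

  open ActsFreelyOn

  without-orbit : {S : Pred (Fin N) p} → ActsFreelyOn S → S x → ActsFreelyOn (S ∩ ∁ (_∈ orbit x))
  without-orbit free Sx = record
    { σ-closed = λ (Sy , y∉orbit) → σ-closed free Sy , y∉orbit ∘ σ-orbit⁻
    ; τ-closed = λ (Sy , y∉orbit) → τ-closed free Sy , y∉orbit ∘ τ-orbit⁻ (commute free Sx)
    ; commute  = commute free ∘ proj₁
    ; στ-fpf   = στ-fpf free ∘ proj₁
    }

  4∣count : {S : Pred (Fin N) p} (S? : Decidable S) → ActsFreelyOn S → 4 ∣ count S?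
  4∣count S? free = go S? free (<-wellFounded (count S?))
    where
    go : {S : Pred (Fin N) p} (S? : Decidable S) → ActsFreelyOn S → Acc _<_ (count S?) → 4 ∣ count S?
    go S? free (acc smaller) with any? S?
    ... | no ¬∃S       = subst (4 ∣_) (sym (count-empty S? λ x Sx → ¬∃S (x , Sx))) (4 ∣0)
    ... | yes (x , Sx) = subst (4 ∣_) (sym removal) (∣m∣n⇒∣m+n ∣-refl (go rest? (without-orbit free Sx) (smaller rest<)))
      where
      rest? : Decidable (_ ∩ ∁ (_∈ orbit x))
      rest? = S? ∩? ∁? (_∈? orbit x)
      removal : count S? ≡ 4 + count rest?
      removal = count-remove S? (orbit-unique (στ-fpf free Sx))
        (Sx ∷ σ-closed free Sx ∷ τ-closed free Sx ∷ σ-closed free (τ-closed free Sx) ∷ [])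
      rest< : count rest? < count S?
      rest< = subst (count rest? <_) (sym removal) (m<n+m _ z<s)

≢-opposite : (i : Fin 2) → i ≢ opposite i
≢-opposite zero       ()
≢-opposite (suc zero) ()

≢opposite⇒≡ : {i j : Fin 2} → i ≢ opposite j → i ≡ j
≢opposite⇒≡ {zero}     {zero}     _       = refl
≢opposite⇒≡ {zero}     {suc zero} i≢opp-j = contradiction refl i≢opp-j
≢opposite⇒≡ {suc zero} {zero}     i≢opp-j = contradiction refl i≢opp-j
≢opposite⇒≡ {suc zero} {suc zero} _       = refl

4∣⇒≡4 : ∀ {m} → 4 ∣ m → 2 ≤ m → m ≤ 6 → m ≡ 4
4∣⇒≡4 (divides zero refl)          ()
4∣⇒≡4 (divides (suc zero) refl)    _ _ = refl
4∣⇒≡4 (divides (suc (suc q)) refl) _ (s≤s (s≤s (s≤s (s≤s (s≤s (s≤s ()))))))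

Orb-closed : {α : Gen → Fin N → Fin N} {ok : Gen → Set} (S : Pred (Fin N) p) →
             (∀ {g x} → ok g → S x → S (α g x)) → ∀ {x y} → Orb α ok x y → S x → S y
Orb-closed S closed here               Sx = Sx
Orb-closed S closed (step g ok-g path) Sx = Orb-closed S closed path (closed ok-g Sx)

module Flags {N : ℕ} (M : GMap N) where

  open GMap M

  α₀ α₁ α₂ : Fin N → Fin N
  α₀ = α g₀
  α₁ = α g₁
  α₂ = α g₂

  α-selfInverse : ∀ g {x y} → α g x ≡ y → α g y ≡ x
  α-selfInverse g = involutive⇒selfInverse (invol g)

  α-injective : ∀ g {x y} → α g x ≡ α g y → x ≡ y
  α-injective g = involutive⇒injective (invol g)

module VertexStars {N n : ℕ} (M : GMap N) (cV : Fin N → Fin n)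
  (cV-invariant : ∀ g x → VertGen g → cV (GMap.α M g x) ≡ cV x)
  (cV-separates : ∀ x y → cV x ≡ cV y → Orb (GMap.α M) VertGen x y) where

  open GMap M
  open Flags M

  At : Fin n → Pred (Fin N) 0ℓ
  At v x = cV x ≡ v

  At? : (v : Fin n) → Decidable (At v)
  At? v x = cV x ≟ v

  cV-α₁ : ∀ x → cV (α₁ x) ≡ cV x
  cV-α₁ x = cV-invariant g₁ x _

  cV-α₂ : ∀ x → cV (α₂ x) ≡ cV x
  cV-α₂ x = cV-invariant g₂ x _

  module _ {v : Fin n} {u : Fin N} (u-at : At v u) where

    degree-1-flags : countLabel cV v ≡ 2 * 1 → ∀ {z} → At v z → z ∈ u ∷ α₁ u ∷ []
    degree-1-flags flags = count-saturated (At? v) ((fpf g₁ u ∘ sym ∷ []) ∷ [] ∷ [])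
      (u-at ∷ trans (cV-α₁ u) u-at ∷ []) (≤-reflexive flags)

    -- If α₁ u ≡ α₂ u, then {u, α₁ u} is closed under α₁ and α₂, so it contains the whole vertex.
    α₁≢α₂ : 2 < countLabel cV v → α₁ u ≢ α₂ u
    α₁≢α₂ 2<flags α₁u≡α₂u = <⇒≱ 2<flags (count≤length (At? v) λ {z} z-at →
        Orb-closed (_∈ u ∷ α₁ u ∷ []) closed (cV-separates u z (trans u-at (sym z-at))) (here refl))
      where
      closed : ∀ {g z} → VertGen g → z ∈ u ∷ α₁ u ∷ [] → α g z ∈ u ∷ α₁ u ∷ []
      closed {g₁} _ (here refl)         = there (here refl)
      closed {g₁} _ (there (here refl)) = here (invol g₁ u)
      closed {g₂} _ (here refl)         = there (here (sym α₁u≡α₂u))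
      closed {g₂} _ (there (here refl)) = here (trans (cong α₂ α₁u≡α₂u) (invol g₂ u))

    α₁α₂≡α₂α₁ : countLabel cV v ≡ 2 * 2 → α₁ (α₂ u) ≡ α₂ (α₁ u)
    α₁α₂≡α₂α₁ flags = from-orbit (count-saturated (At? v) (orbit-unique (α₁u≢α₂u ∘ sym ∘ α-selfInverse g₂))
      (u-at ∷ trans (cV-α₂ u) u-at ∷ trans (cV-α₁ u) u-at ∷ trans (cV-α₂ _) (trans (cV-α₁ u) u-at) ∷ [])
      (≤-reflexive flags) (trans (cV-α₁ _) (trans (cV-α₂ u) u-at)))
      where
      open KleinOrbit α₂ α₁ (invol g₂) (invol g₁) (fpf g₂) (fpf g₁)
      α₁u≢α₂u : α₁ u ≢ α₂ u
      α₁u≢α₂u = α₁≢α₂ (subst (2 <_) (sym flags) (s≤s (s≤s (s≤s z≤n))))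
      from-orbit : α₁ (α₂ u) ∈ orbit u → α₁ (α₂ u) ≡ α₂ (α₁ u)
      from-orbit (here α₁α₂u≡u)                             = contradiction (α-selfInverse g₁ α₁α₂u≡u) α₁u≢α₂u
      from-orbit (there (here α₁α₂u≡α₂u))                   = contradiction α₁α₂u≡α₂u (fpf g₁ (α₂ u))
      from-orbit (there (there (here α₁α₂u≡α₁u)))           = contradiction (α-injective g₁ α₁α₂u≡α₁u) (fpf g₂ u)
      from-orbit (there (there (there (here α₁α₂u≡α₂α₁u)))) = α₁α₂u≡α₂α₁u

module TwoBalancedCountries {N n : ℕ} (M : GMap N)
  (cV : Fin N → Fin n)
  (cV-invariant : ∀ g x → VertGen g → cV (GMap.α M g x) ≡ cV x)
  (cV-separates : ∀ x y → cV x ≡ cV y → Orb (GMap.α M) VertGen x y)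
  (cF : Fin N → Fin 2)
  (cF-invariant : ∀ g x → FaceGen g → cF (GMap.α M g x) ≡ cF x)
  (cF-balanced : ∀ i j → countLabel cF i ≡ countLabel cF j)
  (w leaf : Fin n)
  (w-degree : countLabel cV w ≡ 2 * 3)
  (leaf-degree : countLabel cV leaf ≡ 2 * 1)
  (other-degree : ∀ v → v ≢ w → v ≢ leaf → countLabel cV v ≡ 2 * 2) where

  open GMap M
  open Flags M
  open VertexStars M cV cV-invariant cV-separates

  private
    variable
      x y : Fin N

  cF-α₀ : ∀ x → cF (α₀ x) ≡ cF x
  cF-α₀ x = cF-invariant g₀ x _

  cF-α₁ : ∀ x → cF (α₁ x) ≡ cF x
  cF-α₁ x = cF-invariant g₁ x _

  leaf-flag : ∃ (At leaf)
  leaf-flag = count-witness (At? leaf) (subst (0 <_) (sym leaf-degree) z<s)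

  ℓ : Fin N
  ℓ = proj₁ leaf-flag

  ℓ-at-leaf : At leaf ℓ
  ℓ-at-leaf = proj₂ leaf-flag

  A B : Fin 2
  A = cF ℓ
  B = opposite A

  leaf-in-A : At leaf x → cF x ≡ A
  leaf-in-A x-at with degree-1-flags ℓ-at-leaf leaf-degree x-at
  ... | here refl         = refl
  ... | there (here refl) = cF-α₁ ℓ

  InB : Pred (Fin N) 0ℓ
  InB x = cF x ≡ B

  InB? : Decidable InB
  InB? x = cF x ≟ B

  Interior : Pred (Fin N) 0ℓ
  Interior = InB ∩ InB ∘ α₂

  Interior? : Decidable Interior
  Interior? = InB? ∩? InB? ∘ α₂

  interior-nonempty : ∃ Interior
  interior-nonempty = count-witness Interior? (begin-strict
    0                               <⟨ unique⇒length≤count (∁? InB? ∩? ∁? InB? ∘ α₂) ([] ∷ []) (ℓ-outside-B ∷ []) ⟩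
    count (∁? InB? ∩? ∁? InB? ∘ α₂) ≡⟨ count-∩-∘-balanced InB? (invol g₂) B-balanced ⟨
    count Interior?                 ∎)
    where
    open ≤-Reasoning
    ℓ-outside-B : (∁ InB ∩ ∁ InB ∘ α₂) ℓ
    ℓ-outside-B = ≢-opposite A , subst (_≢ B) (sym (leaf-in-A (trans (cV-α₂ ℓ) ℓ-at-leaf))) (≢-opposite A)
    B-balanced : count InB? ≡ count (∁? InB?)
    B-balanced = trans (cF-balanced B A) (count-cong (λ x → cF x ≟ A) (∁? InB?)
      (λ cFx≡A → subst (_≢ B) (sym cFx≡A) (≢-opposite A)) ≢opposite⇒≡)

  interior-α₀ : Interior x → Interior (α₀ x)
  interior-α₀ {x} (Bx , Bα₂x) =
    trans (cF-α₀ x) Bx , trans (cong cF (sym (comm02 x))) (trans (cF-α₀ (α₂ x)) Bα₂x)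

  interior-α₂ : Interior x → Interior (α₂ x)
  interior-α₂ {x} (Bx , Bα₂x) = Bα₂x , trans (cong cF (invol g₂ x)) Bx

  interior-off-leaf : Interior x → ¬ At leaf x
  interior-off-leaf (Bx , _) x-at = ≢-opposite A (trans (sym (leaf-in-A x-at)) Bx)

  interior-degree-2 : Interior x → ¬ At w x → countLabel cV (cV x) ≡ 2 * 2
  interior-degree-2 {x} Ix x-off-w = other-degree (cV x) x-off-w (interior-off-leaf Ix)

  interior-α₁-off-w : Interior x → ¬ At w x → Interior (α₁ x)
  interior-α₁-off-w {x} Ix@(Bx , Bα₂x) x-off-w =
    trans (cF-α₁ x) Bx , trans (cong cF (sym α₁α₂x≡α₂α₁x)) (trans (cF-α₁ (α₂ x)) Bα₂x)
    where
    α₁α₂x≡α₂α₁x : α₁ (α₂ x) ≡ α₂ (α₁ x)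
    α₁α₂x≡α₂α₁x = α₁α₂≡α₂α₁ refl (interior-degree-2 Ix x-off-w)

  4∣interior : 4 ∣ count Interior?
  4∣interior = K.4∣count Interior? record
    { σ-closed = interior-α₀
    ; τ-closed = interior-α₂
    ; commute  = λ {x} _ → comm02 x
    ; στ-fpf   = λ {x} _ → fpf02 x
    }
    where module K = KleinOrbit α₀ α₂ (invol g₀) (invol g₂) (fpf g₀) (fpf g₂)

  4∣interior-off-w : 4 ∣ count (Interior? ∩? ∁? (At? w))
  4∣interior-off-w = K.4∣count (Interior? ∩? ∁? (At? w)) record
    { σ-closed = λ {x} (Ix , x-off-w) → interior-α₁-off-w Ix x-off-w , x-off-w ∘ trans (sym (cV-α₁ x))
    ; τ-closed = λ {x} (Ix , x-off-w) → interior-α₂ Ix , x-off-w ∘ trans (sym (cV-α₂ x))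
    ; commute  = λ (Ix , x-off-w) → α₁α₂≡α₂α₁ refl (interior-degree-2 Ix x-off-w)
    ; στ-fpf   = λ (Ix , x-off-w) α₁α₂x≡x → α₁≢α₂ refl
        (subst (2 <_) (sym (interior-degree-2 Ix x-off-w)) (s≤s (s≤s (s≤s z≤n)))) (α-selfInverse g₁ α₁α₂x≡x)
    }
    where module K = KleinOrbit α₁ α₂ (invol g₁) (invol g₂) (fpf g₁) (fpf g₂)

  interior-at-w : Interior y → At w y → count (Interior? ∩? At? w) ≡ 4
  interior-at-w {y} Iy y-at-w = 4∣⇒≡4 4∣interior-at-w 2≤interior-at-w interior-at-w≤6
    where
    4∣interior-at-w : 4 ∣ count (Interior? ∩? At? w)
    4∣interior-at-w = ∣m+n∣m⇒∣n
      (subst (4 ∣_) (trans (count-split Interior? (At? w)) (+-comm (count (Interior? ∩? At? w)) _)) 4∣interior)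
      4∣interior-off-w
    2≤interior-at-w : 2 ≤ count (Interior? ∩? At? w)
    2≤interior-at-w = unique⇒length≤count (Interior? ∩? At? w) ((fpf g₂ y ∘ sym ∷ []) ∷ [] ∷ [])
      ((Iy , y-at-w) ∷ (interior-α₂ Iy , trans (cV-α₂ y) y-at-w) ∷ [])
    interior-at-w≤6 : count (Interior? ∩? At? w) ≤ 6
    interior-at-w≤6 = subst (count (Interior? ∩? At? w) ≤_) w-degree (count-mono (Interior? ∩? At? w) (At? w) proj₂)

  exterior-at-w : Interior y → At w y → count (At? w ∩? ∁? Interior?) ≡ 2
  exterior-at-w Iy y-at-w = +-cancelˡ-≡ 4 _ _ (begin
    4 + count (At? w ∩? ∁? Interior?)                          ≡⟨ cong (_+ count (At? w ∩? ∁? Interior?)) interior≡4 ⟨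
    count (At? w ∩? Interior?) + count (At? w ∩? ∁? Interior?) ≡⟨ count-split (At? w) Interior? ⟨
    count (At? w)                                              ≡⟨ w-degree ⟩
    4 + 2                                                      ∎)
    where
    open ≡-Reasoning
    interior≡4 : count (At? w ∩? Interior?) ≡ 4
    interior≡4 = trans (count-cong (At? w ∩? Interior?) (Interior? ∩? At? w) swap swap) (interior-at-w Iy y-at-w)

  -- If u and α₂ u were the only exterior flags at v, then α₁ u and α₁ (α₂ u) would be interior,
  -- and they lie in the same countries as u and α₂ u.
  ¬two-exterior : ∀ {v} → 2 < countLabel cV v → count (At? v ∩? ∁? Interior?) ≢ 2
  ¬two-exterior {v} 2<flags two with count-witness (At? v ∩? ∁? Interior?) (subst (0 <_) (sym two) z<s)
  ... | u , u-at , ¬Iu = ¬Iu (trans (sym (cF-α₁ u)) (proj₁ Iα₁u) , trans (sym (cF-α₁ (α₂ u))) (proj₁ Iα₁α₂u))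
    where
    α₂u-exterior : (At v ∩ ∁ Interior) (α₂ u)
    α₂u-exterior = trans (cV-α₂ u) u-at , ¬Iu ∘ subst Interior (invol g₂ u) ∘ interior-α₂
    interior-unless : At v x → x ∉ u ∷ α₂ u ∷ [] → Interior x
    interior-unless {x} x-at x∉ with Interior? x
    ... | yes Ix = Ix
    ... | no ¬Ix = contradiction (count-saturated (At? v ∩? ∁? Interior?) ((fpf g₂ u ∘ sym ∷ []) ∷ [] ∷ [])
                     ((u-at , ¬Iu) ∷ α₂u-exterior ∷ []) (≤-reflexive two) (x-at , ¬Ix)) x∉
    Iα₁u : Interior (α₁ u)
    Iα₁u = interior-unless (trans (cV-α₁ u) u-at) λ
      { (here α₁u≡u)           → fpf g₁ u α₁u≡u
      ; (there (here α₁u≡α₂u)) → α₁≢α₂ u-at 2<flags α₁u≡α₂u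
      }
    Iα₁α₂u : Interior (α₁ (α₂ u))
    Iα₁α₂u = interior-unless (trans (cV-α₁ (α₂ u)) (trans (cV-α₂ u) u-at)) λ
      { (here α₁α₂u≡u)           → α₁≢α₂ u-at 2<flags (α-selfInverse g₁ α₁α₂u≡u)
      ; (there (here α₁α₂u≡α₂u)) → fpf g₁ (α₂ u) α₁α₂u≡α₂u
      }

  interior-off-w : Interior x → ¬ At w x
  interior-off-w Ix x-at-w =
    ¬two-exterior (subst (2 <_) (sym w-degree) (s≤s (s≤s (s≤s z≤n)))) (exterior-at-w Ix x-at-w)

  interior-closed : ∀ g → Interior x → Interior (α g x)
  interior-closed g₀ Ix = interior-α₀ Ix
  interior-closed g₁ Ix = interior-α₁-off-w Ix (interior-off-w Ix)
  interior-closed g₂ Ix = interior-α₂ Ix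

  impossible : ⊥
  impossible with interior-nonempty
  ... | x , Ix = ≢-opposite A (proj₁ (Orb-closed Interior (λ {g} _ → interior-closed g) (connected x ℓ) Ix))

dSeq-last : ∀ k → dSeq (2 + k) (fromℕ (suc k)) ≡ 1
dSeq-last k with toℕ (fromℕ (suc k)) N.≟ suc k
... | yes _    = refl
... | no last≢ = contradiction (toℕ-fromℕ (suc k)) last≢

dSeq-middle : ∀ k (v : Fin (2 + k)) → v ≢ zero → v ≢ fromℕ (suc k) → dSeq (2 + k) v ≡ 2
dSeq-middle k v v≢first v≢last with toℕ v N.≟ 0
... | yes v≡0 = contradiction (toℕ-injective v≡0) v≢first
... | no _ with toℕ v N.≟ suc k
...   | yes v≡last = contradiction (toℕ-injective (trans v≡last (sym (toℕ-fromℕ (suc k))))) v≢last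
...   | no _       = refl

proposition6p2 : (n : ℕ) → 2 ≤ n → ¬ Realizable n (dSeq n) 2 (tSeq n)
proposition6p2 (suc (suc k)) (s≤s (s≤s z≤n))
  (_ , M , (cV , cV-invariant , cV-separates , cV-count) , (cF , cF-invariant , _ , cF-count)) =
  TwoBalancedCountries.impossible M cV cV-invariant cV-separates cF cF-invariant
    (λ i j → trans (cF-count i) (sym (cF-count j)))
    zero (fromℕ (suc k))
    (cV-count zero)
    (trans (cV-count (fromℕ (suc k))) (cong (2 *_) (dSeq-last k)))
    (λ v v≢first v≢last → trans (cV-count v) (cong (2 *_) (dSeq-middle k v v≢first v≢last)))
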